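{- Let $\mathcal A\subseteq\binom{[n]}{k}$ be $t$-intersecting. Then for every $1\le i<j\le n$, \[\zeta_{k-1}(\Delta_{ij}(\mathcal A))\ge\zeta_{k-1}(\mathcal A).\]
   Context: $\binom{[n]}{k}$ is the set of $k$-subsets of $[n]=\{1,\dots,n\}$; $\mathcal A$ is $t$-intersecting if $|A\cap B|\ge t$ for all $A,B\in\mathcal A$. For $\mathcal A\subseteq\binom{[n]}{k}$, $\zeta_{k-1}(\mathcal A)=|\{\{F,G\}: F,G\in\mathcal A,\ |F\cap G|=k-1\}|$. For $i,j\in[n]$ and $A\in\mathcal A$, the shift is $\delta_{ij}(A)=(A\setminus\{j\})\cup\{i\}$ if $j\in A$, $i\notin A$ and $(A\setminus\{j\})\cup\{i\}\notin\mathcal A$, and $\delta_{ij}(A)=A$ otherwise; $\Delta_{ij}(\mathcal A)=\{\delta_{ij}(A):A\in\mathcal A\}$. -}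

module Defs where

open import Data.Nat using (ℕ; zero; suc; _+_; _∸_; _≤_)
open import Data.Bool using (Bool; true; false; if_then_else_)
import Data.Bool.Properties as BoolP
open import Data.Fin using (Fin)
open import Data.Fin.Subset using (Subset; _∩_; ∣_∣; _∈_; _∉_; inside; outside)
open import Data.Fin.Subset.Properties using (_∈?_)
open import Data.Vec using (_[_]≔_)
open import Data.Vec.Properties using (≡-dec)
open import Data.List using (List; []; _∷_; map; length; filter)
open import Data.List.Relation.Unary.Any using (any?)
import Data.List.Membership.Propositional as LM
open import Data.List.Relation.Unary.Unique.Propositional using (Unique)
open import Data.Product using (_×_)
open import Relation.Nullary using (Dec; yes; no; ¬_)
open import Relation.Binary.PropositionalEquality using (_≡_)
import Data.Nat as ℕ

-- Ground set [n] is modelled by Fin n; a subset of [n] is a Subset n (Vec Bool n).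
-- A family 𝒜 ⊆ (n choose k) is a duplicate-free list of subsets, each of size k.

_≟S_ : ∀ {n} → (A B : Subset n) → Dec (A ≡ B)
_≟S_ = ≡-dec BoolP._≟_

_∈𝒜?_ : ∀ {n} → (A : Subset n) → (𝒜 : List (Subset n)) → Dec (A LM.∈ 𝒜)
A ∈𝒜? 𝒜 = any? (A ≟S_) 𝒜

IsFamily : ∀ {n} → ℕ → List (Subset n) → Set
IsFamily {n} k 𝒜 = Unique 𝒜 × (∀ A → A LM.∈ 𝒜 → ∣ A ∣ ≡ k)

IsTIntersecting : ∀ {n} → ℕ → List (Subset n) → Set
IsTIntersecting t 𝒜 = ∀ A B → A LM.∈ 𝒜 → B LM.∈ 𝒜 → t ≤ ∣ A ∩ B ∣

swapIn : ∀ {n} → Fin n → Fin n → Subset n → Subset n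
swapIn i j A = (A [ j ]≔ outside) [ i ]≔ inside

δ : ∀ {n} → Fin n → Fin n → List (Subset n) → Subset n → Subset n
δ i j 𝒜 A with j ∈? A | i ∈? A | swapIn i j A ∈𝒜? 𝒜
... | yes _ | no _ | no _ = swapIn i j A
... | _     | _    | _    = A

-- Δ_ij(𝒜) = { δ_ij(A) : A ∈ 𝒜 }  (δ_ij is injective on 𝒜, so no duplicates arise)
Δ : ∀ {n} → Fin n → Fin n → List (Subset n) → List (Subset n)
Δ i j 𝒜 = map (δ i j 𝒜) 𝒜

-- number of unordered pairs {F,G} of (distinct list positions) with |F ∩ G| = m
ζ : ∀ {n} → ℕ → List (Subset n) → ℕ
ζ m [] = 0
ζ m (F ∷ 𝒜) = length (filter (λ G → ∣ F ∩ G ∣ ℕ.≟ m) 𝒜) + ζ m 𝒜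

-- Count ordered pairs (F , G) of 𝒜 × 𝒜 with |F ∩ G| = k − 1. By symmetry this number is the
-- diagonal count plus 2ζ, and shifting preserves sizes, so it suffices to show that the ordered
-- count does not drop. If a pair meets in k − 1 points before the shift but not after it, one of
-- its sets, F, moves (j ∈ F, i ∉ F, F′ = F − j + i ∉ 𝒜) while the other, G, is blocked
-- (j ∈ G, i ∉ G, G′ ∈ 𝒜). Then (F , G′) meets in k − 2 points before the shift and F′ ∩ G′ has
-- size k − 1 after it, and (F , G) ↦ (F , G′) is injective on such pairs.
module Submission where

open import Defs
open import Data.Bool using (Bool; true; false; _∧_; if_then_else_)
open import Data.Bool.Properties using (¬-not)
open import Data.Fin using (Fin; zero; suc; _<_)
import Data.Fin.Properties as Fin
open import Data.Fin.Subset using (Subset; _∩_; ∣_∣; inside; outside; _⊆_)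
open import Data.Fin.Subset.Properties
  using (_∈?_; ∩-comm; ∩-idem; ∣p∩q∣≤∣q∣; p⊆q⇒∣p∣≤∣q∣; drop-∷-⊆; p∩q⊆p; p∩q⊆q)
open import Data.List using (List; []; _∷_; _++_; length; filter; map; cartesianProduct)
open import Data.List.Properties using (length-++; filter-++; filter-≐)
open import Data.List.Membership.Propositional using (_∈_; _∉_)
open import Data.List.Membership.Propositional.Properties
  using (∈-∃++; ∈-++⁻; ∈-++⁺ˡ; ∈-++⁺ʳ; ∈-filter⁺; ∈-filter⁻; ∈-cartesianProduct⁺; ∈-cartesianProduct⁻)
open import Data.List.Relation.Unary.Any using (here; there)
import Data.List.Relation.Unary.All as All
open import Data.List.Relation.Unary.AllPairs using (_∷_)
open import Data.List.Relation.Unary.Unique.Propositional using (Unique)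
import Data.List.Relation.Unary.Unique.Propositional.Properties as Unique
open import Data.Nat using (ℕ; zero; suc; _+_; _*_; _∸_; _≤_; z≤n; s≤s)
import Data.Nat as ℕ
open import Data.Nat.Properties
  using ( +-comm; +-suc; +-identityʳ; +-commutativeSemigroup; +-cancelʳ-≡; +-cancelˡ-≤; *-cancelˡ-≤
        ; +-mono-≤; ≤-reflexive; ≤-trans; <⇒≢; m≤n+m; m∸n+n≡m; suc-injective; 1+n≢n; module ≤-Reasoning)
open import Algebra.Properties.CommutativeSemigroup +-commutativeSemigroup using (x∙yz≈y∙xz; xy∙z≈xz∙y)
open import Data.Nat.Tactic.RingSolver using (solve-∀)
open import Data.Product using (_×_; _,_; proj₁; proj₂; swap; uncurry)
open import Data.Product.Properties using (,-injectiveˡ; ,-injectiveʳ)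
open import Data.Sum using (_⊎_; inj₁; inj₂)
import Data.Vec as Vec
open import Data.Vec using ([]; _∷_; lookup; _[_]≔_)
open import Data.Vec.Properties using ([]=⇒lookup; lookup⇒[]=; lookup∘update; lookup∘update′)
open import Data.Vec.Relation.Binary.Pointwise.Extensional using (ext; Pointwise-≡⇒≡)
open import Function using (_∘_)
open import Level using (Level)
open import Relation.Binary.Core using (Rel)
open import Relation.Binary.Definitions using (Symmetric) renaming (Decidable to Decidable₂)
open import Relation.Binary.PropositionalEquality
  using (_≡_; _≢_; refl; sym; trans; cong; cong₂; subst; subst₂; module ≡-Reasoning)
open import Relation.Nullary using (Dec; yes; no; ¬_; contradiction)
open import Relation.Unary using (Pred; Decidable; _≐_)
open import Relation.Unary.Properties using (_∩?_; ∁?)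

private
  variable
    a b p q r : Level
    A : Set a
    B : Set b
    n : ℕ

length-≤-injectionOn : {xs : List A} {ys : List B} (f : A → B) → Unique xs →
                       (∀ {x} → x ∈ xs → f x ∈ ys) →
                       (∀ {x y} → x ∈ xs → y ∈ xs → f x ≡ f y → x ≡ y) →
                       length xs ≤ length ys
length-≤-injectionOn {xs = []}     f _             _  _     = z≤n
length-≤-injectionOn {xs = x ∷ xs} f (x∉xs ∷ xs!) f∈ f-inj
  with ys₁ , ys₂ , refl ← ∈-∃++ (f∈ (here refl)) = begin
    suc (length xs)                 ≤⟨ s≤s (length-≤-injectionOn f xs! f∈′ (λ p q → f-inj (there p) (there q))) ⟩
    suc (length (ys₁ ++ ys₂))       ≡⟨ cong suc (length-++ ys₁) ⟩
    suc (length ys₁ + length ys₂)   ≡⟨ +-suc (length ys₁) (length ys₂) ⟨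
    length ys₁ + length (f x ∷ ys₂) ≡⟨ length-++ ys₁ ⟨
    length (ys₁ ++ f x ∷ ys₂)       ∎
  where
  open ≤-Reasoning
  f∈′ : ∀ {z} → z ∈ xs → f z ∈ ys₁ ++ ys₂
  f∈′ z∈xs with ∈-++⁻ ys₁ (f∈ (there z∈xs))
  ... | inj₁ fz∈ys₁         = ∈-++⁺ˡ fz∈ys₁
  ... | inj₂ (here fz≡fx)   = contradiction (f-inj (here refl) (there z∈xs) (sym fz≡fx)) (All.lookup x∉xs z∈xs)
  ... | inj₂ (there fz∈ys₂) = ∈-++⁺ʳ ys₁ fz∈ys₂

count : {P : Pred A p} → Decidable P → List A → ℕ
count P? xs = length (filter P? xs)

count-map : {P : Pred B p} (P? : Decidable P) (f : A → B) (xs : List A) → count P? (map f xs) ≡ count (P? ∘ f) xs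
count-map P? f []       = refl
count-map P? f (x ∷ xs) with P? (f x)
... | yes _ = cong suc (count-map P? f xs)
... | no _  = count-map P? f xs

module _ {P : Pred A p} {Q : Pred A q} (P? : Decidable P) (Q? : Decidable Q) where

  count-≐ : P ≐ Q → ∀ xs → count P? xs ≡ count Q? xs
  count-≐ P≐Q xs = cong length (filter-≐ P? Q? P≐Q xs)

  count-split : ∀ xs → count P? xs ≡ count (P? ∩? Q?) xs + count (P? ∩? ∁? Q?) xs
  count-split []       = refl
  count-split (x ∷ xs) with P? x | Q? x
  ... | yes _ | yes _ = cong suc (count-split xs)
  ... | yes _ | no _  = trans (cong suc (count-split xs)) (sym (+-suc _ _))
  ... | no _  | _     = count-split xs

  count-≤-injectionOn : {xs : List A} (g : A → A) → Unique xs →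
                        (∀ {x} → x ∈ xs → P x → g x ∈ xs × Q (g x)) →
                        (∀ {x y} → x ∈ xs → y ∈ xs → P x → P y → g x ≡ g y → x ≡ y) →
                        count P? xs ≤ count Q? xs
  count-≤-injectionOn {xs = xs} g xs! g∈ g-inj = length-≤-injectionOn g (Unique.filter⁺ P? xs!) g∈′ g-inj′
    where
    g∈′ : ∀ {x} → x ∈ filter P? xs → g x ∈ filter Q? xs
    g∈′ x∈ = let x∈xs , Px = ∈-filter⁻ P? x∈ ; gx∈xs , Qgx = g∈ x∈xs Px in ∈-filter⁺ Q? gx∈xs Qgx
    g-inj′ : ∀ {x y} → x ∈ filter P? xs → y ∈ filter P? xs → g x ≡ g y → x ≡ y
    g-inj′ x∈ y∈ = let x∈xs , Px = ∈-filter⁻ P? x∈ ; y∈xs , Py = ∈-filter⁻ P? y∈ in g-inj x∈xs y∈xs Px Py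

module _ {P : Pred A p} {Q : Pred A q} (P? : Decidable P) (Q? : Decidable Q) where

  count-≤-exchange : {xs : List A} (g : A → A) → Unique xs →
                     (∀ {x} → x ∈ xs → P x → ¬ Q x → g x ∈ xs × Q (g x) × ¬ P (g x)) →
                     (∀ {x y} → x ∈ xs → y ∈ xs → P x × ¬ Q x → P y × ¬ Q y → g x ≡ g y → x ≡ y) →
                     count P? xs ≤ count Q? xs
  count-≤-exchange {xs = xs} g xs! g∈ g-inj = begin
    count P? xs                                           ≡⟨ count-split P? Q? xs ⟩
    count (P? ∩? Q?) xs + count (P? ∩? ∁? Q?) xs         ≤⟨ +-mono-≤ (≤-reflexive common) lost≤gained ⟩
    count (Q? ∩? P?) xs + count (Q? ∩? ∁? P?) xs         ≡⟨ count-split Q? P? xs ⟨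
    count Q? xs                                           ∎
    where
    open ≤-Reasoning
    common : count (P? ∩? Q?) xs ≡ count (Q? ∩? P?) xs
    common = count-≐ (P? ∩? Q?) (Q? ∩? P?) (swap , swap) xs
    lost≤gained : count (P? ∩? ∁? Q?) xs ≤ count (Q? ∩? ∁? P?) xs
    lost≤gained = count-≤-injectionOn (P? ∩? ∁? Q?) (Q? ∩? ∁? P?) g xs! (λ x∈xs (Px , ¬Qx) → g∈ x∈xs Px ¬Qx) g-inj

module _ {R : Rel A r} (R? : Decidable₂ R) where

  countPairs : List A → ℕ
  countPairs []       = 0
  countPairs (x ∷ xs) = count (R? x) xs + countPairs xs

  countOrdered : List A → List A → ℕ
  countOrdered xs ys = count (uncurry R?) (cartesianProduct xs ys)

  countOrdered-∷ˡ : ∀ x xs ys → countOrdered (x ∷ xs) ys ≡ count (R? x) ys + countOrdered xs ys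
  countOrdered-∷ˡ x xs ys = begin
    count (uncurry R?) (map (x ,_) ys ++ cartesianProduct xs ys)
      ≡⟨ cong length (filter-++ (uncurry R?) (map (x ,_) ys) (cartesianProduct xs ys)) ⟩
    length (filter (uncurry R?) (map (x ,_) ys) ++ filter (uncurry R?) (cartesianProduct xs ys))
      ≡⟨ length-++ (filter (uncurry R?) (map (x ,_) ys)) ⟩
    count (uncurry R?) (map (x ,_) ys) + countOrdered xs ys
      ≡⟨ cong (_+ countOrdered xs ys) (count-map (uncurry R?) (x ,_) ys) ⟩
    count (R? x) ys + countOrdered xs ys
      ∎
    where open ≡-Reasoning

  countOrdered-∷ʳ : ∀ xs y ys → countOrdered xs (y ∷ ys) ≡ count (λ x → R? x y) xs + countOrdered xs ys
  countOrdered-∷ʳ []       y ys = refl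
  countOrdered-∷ʳ (x ∷ xs) y ys = begin
    countOrdered (x ∷ xs) (y ∷ ys)
      ≡⟨ countOrdered-∷ˡ x xs (y ∷ ys) ⟩
    count (R? x) (y ∷ ys) + countOrdered xs (y ∷ ys)
      ≡⟨ cong (count (R? x) (y ∷ ys) +_) (countOrdered-∷ʳ xs y ys) ⟩
    count (R? x) (y ∷ ys) + (count (λ z → R? z y) xs + countOrdered xs ys)
      ≡⟨ exchange ⟩
    count (λ z → R? z y) (x ∷ xs) + (count (R? x) ys + countOrdered xs ys)
      ≡⟨ cong (count (λ z → R? z y) (x ∷ xs) +_) (countOrdered-∷ˡ x xs ys) ⟨
    count (λ z → R? z y) (x ∷ xs) + countOrdered (x ∷ xs) ys
      ∎
    where
    open ≡-Reasoning
    exchange : count (R? x) (y ∷ ys) + (count (λ z → R? z y) xs + countOrdered xs ys)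
             ≡ count (λ z → R? z y) (x ∷ xs) + (count (R? x) ys + countOrdered xs ys)
    exchange with R? x y
    ... | yes _ = cong suc (x∙yz≈y∙xz (count (R? x) ys) (count (λ z → R? z y) xs) (countOrdered xs ys))
    ... | no _  = x∙yz≈y∙xz (count (R? x) ys) (count (λ z → R? z y) xs) (countOrdered xs ys)

  countOrdered-diagonal : Symmetric R → ∀ xs → countOrdered xs xs ≡ count (λ x → R? x x) xs + 2 * countPairs xs
  countOrdered-diagonal R-sym []       = refl
  countOrdered-diagonal R-sym (x ∷ xs) = begin
    countOrdered (x ∷ xs) (x ∷ xs)
      ≡⟨ countOrdered-∷ˡ x xs (x ∷ xs) ⟩
    count (R? x) (x ∷ xs) + countOrdered xs (x ∷ xs)
      ≡⟨ cong (count (R? x) (x ∷ xs) +_) (countOrdered-∷ʳ xs x xs) ⟩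
    count (R? x) (x ∷ xs) + (count (λ z → R? z x) xs + countOrdered xs xs)
      ≡⟨ cong₂ (λ c d → count (R? x) (x ∷ xs) + (c + d)) column (countOrdered-diagonal R-sym xs) ⟩
    count (R? x) (x ∷ xs) + (count (R? x) xs + (count (λ z → R? z z) xs + 2 * countPairs xs))
      ≡⟨ rearrange ⟩
    count (λ z → R? z z) (x ∷ xs) + 2 * countPairs (x ∷ xs)
      ∎
    where
    open ≡-Reasoning
    column : count (λ z → R? z x) xs ≡ count (R? x) xs
    column = count-≐ (λ z → R? z x) (R? x) (R-sym , R-sym) xs
    shuffle : ∀ c d e → c + (c + (d + 2 * e)) ≡ d + 2 * (c + e)
    shuffle = solve-∀
    rearrange : count (R? x) (x ∷ xs) + (count (R? x) xs + (count (λ z → R? z z) xs + 2 * countPairs xs))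
              ≡ count (λ z → R? z z) (x ∷ xs) + 2 * countPairs (x ∷ xs)
    rearrange with R? x x
    ... | yes _ = cong suc (shuffle (count (R? x) xs) (count (λ z → R? z z) xs) (countPairs xs))
    ... | no _  = shuffle (count (R? x) xs) (count (λ z → R? z z) xs) (countPairs xs)

countPairs-map : {R : Rel B r} (R? : Decidable₂ R) (f : A → B) (xs : List A) →
                 countPairs R? (map f xs) ≡ countPairs (λ x y → R? (f x) (f y)) xs
countPairs-map R? f []       = refl
countPairs-map R? f (x ∷ xs) = cong₂ _+_ (count-map (R? (f x)) f xs) (countPairs-map R? f xs)

⟦_⟧ : Bool → ℕ
⟦ b ⟧ = if b then 1 else 0

∣b∷p∣≡∣p∣+⟦b⟧ : ∀ b (p : Subset n) → ∣ b ∷ p ∣ ≡ ∣ p ∣ + ⟦ b ⟧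
∣b∷p∣≡∣p∣+⟦b⟧ true  p = +-comm 1 ∣ p ∣
∣b∷p∣≡∣p∣+⟦b⟧ false p = sym (+-identityʳ ∣ p ∣)

∣p[x]≔true∩q∣ : ∀ (p q : Subset n) x → lookup p x ≡ false →
                ∣ (p [ x ]≔ true) ∩ q ∣ ≡ ∣ p ∩ q ∣ + ⟦ lookup q x ⟧
∣p[x]≔true∩q∣ (false ∷ p) (d ∷ q) zero    refl = ∣b∷p∣≡∣p∣+⟦b⟧ d (p ∩ q)
∣p[x]≔true∩q∣ (c     ∷ p) (d ∷ q) (suc x) px with c ∧ d
... | true  = cong suc (∣p[x]≔true∩q∣ p q x px)
... | false = ∣p[x]≔true∩q∣ p q x px

∣p[x]≔false∩q∣ : ∀ (p q : Subset n) x → lookup p x ≡ true →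
                 ∣ (p [ x ]≔ false) ∩ q ∣ + ⟦ lookup q x ⟧ ≡ ∣ p ∩ q ∣
∣p[x]≔false∩q∣ (true ∷ p) (d ∷ q) zero    refl = sym (∣b∷p∣≡∣p∣+⟦b⟧ d (p ∩ q))
∣p[x]≔false∩q∣ (c    ∷ p) (d ∷ q) (suc x) px with c ∧ d
... | true  = cong suc (∣p[x]≔false∩q∣ p q x px)
... | false = ∣p[x]≔false∩q∣ p q x px

p⊆q∧∣p∣≡∣q∣⇒p≡q : {p q : Subset n} → p ⊆ q → ∣ p ∣ ≡ ∣ q ∣ → p ≡ q
p⊆q∧∣p∣≡∣q∣⇒p≡q {p = []}          {[]}          _   _ = refl
p⊆q∧∣p∣≡∣q∣⇒p≡q {p = outside ∷ p} {outside ∷ q} p⊆q e =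
  cong (outside ∷_) (p⊆q∧∣p∣≡∣q∣⇒p≡q (drop-∷-⊆ p⊆q) e)
p⊆q∧∣p∣≡∣q∣⇒p≡q {p = outside ∷ p} {inside  ∷ q} p⊆q e =
  contradiction e (<⇒≢ (s≤s (p⊆q⇒∣p∣≤∣q∣ (drop-∷-⊆ p⊆q))))
p⊆q∧∣p∣≡∣q∣⇒p≡q {p = inside  ∷ p} {outside ∷ q} p⊆q e =
  contradiction (p⊆q Vec.here) λ ()
p⊆q∧∣p∣≡∣q∣⇒p≡q {p = inside  ∷ p} {inside  ∷ q} p⊆q e =
  cong (inside ∷_) (p⊆q∧∣p∣≡∣q∣⇒p≡q (drop-∷-⊆ p⊆q) (suc-injective e))

∣∩∣-comm : (p q : Subset n) → ∣ p ∩ q ∣ ≡ ∣ q ∩ p ∣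
∣∩∣-comm p q = cong ∣_∣ (∩-comm p q)

∣∩∣≟ : ∀ m (x y : Subset n) → Dec (∣ x ∩ y ∣ ≡ m)
∣∩∣≟ m x y = ∣ x ∩ y ∣ ℕ.≟ m

ζ≡countPairs : ∀ m (𝒜 : List (Subset n)) → ζ m 𝒜 ≡ countPairs (∣∩∣≟ m) 𝒜
ζ≡countPairs m []      = refl
ζ≡countPairs m (F ∷ 𝒜) = cong (count (∣∩∣≟ m F) 𝒜 +_) (ζ≡countPairs m 𝒜)

module Shift {n} {i j : Fin n} (i≢j : i ≢ j) where

  σ : Subset n → Subset n
  σ = swapIn i j

  record Shiftable (x : Subset n) : Set where
    constructor shiftable
    field
      has-j   : lookup x j ≡ true
      lacks-i : lookup x i ≡ false

  lookup-σ-i : ∀ x → lookup (σ x) i ≡ true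
  lookup-σ-i x = lookup∘update i (x [ j ]≔ outside) inside

  lookup-σ-j : ∀ x → lookup (σ x) j ≡ false
  lookup-σ-j x = trans (lookup∘update′ (i≢j ∘ sym) (x [ j ]≔ outside) inside) (lookup∘update j x outside)

  lookup-σ : ∀ x {p} → p ≢ i → p ≢ j → lookup (σ x) p ≡ lookup x p
  lookup-σ x p≢i p≢j = trans (lookup∘update′ p≢i (x [ j ]≔ outside) inside) (lookup∘update′ p≢j x outside)

  σx-unshiftable : ∀ x → ¬ Shiftable (σ x)
  σx-unshiftable x (shiftable _ σx-i) = contradiction (trans (sym (lookup-σ-i x)) σx-i) λ ()

  σ-injective : ∀ {x y} → Shiftable x → Shiftable y → σ x ≡ σ y → x ≡ y
  σ-injective {x} {y} (shiftable xj xi) (shiftable yj yi) σx≡σy = Pointwise-≡⇒≡ (ext agree)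
    where
    agree : ∀ p → lookup x p ≡ lookup y p
    agree p with p Fin.≟ i | p Fin.≟ j
    ... | yes refl | _        = trans xi (sym yi)
    ... | no _     | yes refl = trans xj (sym yj)
    ... | no p≢i   | no p≢j   =
      trans (sym (lookup-σ x p≢i p≢j)) (trans (cong (λ z → lookup z p) σx≡σy) (lookup-σ y p≢i p≢j))

  ∣σx∩y∣+⟦y_j⟧≡∣x∩y∣+⟦y_i⟧ : ∀ {x} → Shiftable x → ∀ y →
                             ∣ σ x ∩ y ∣ + ⟦ lookup y j ⟧ ≡ ∣ x ∩ y ∣ + ⟦ lookup y i ⟧
  ∣σx∩y∣+⟦y_j⟧≡∣x∩y∣+⟦y_i⟧ {x} (shiftable xj xi) y = begin
    ∣ σ x ∩ y ∣ + ⟦ lookup y j ⟧                   ≡⟨ cong (_+ ⟦ lookup y j ⟧) (∣p[x]≔true∩q∣ x′ y i x′-i) ⟩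
    ∣ x′ ∩ y ∣ + ⟦ lookup y i ⟧ + ⟦ lookup y j ⟧   ≡⟨ xy∙z≈xz∙y ∣ x′ ∩ y ∣ ⟦ lookup y i ⟧ ⟦ lookup y j ⟧ ⟩
    ∣ x′ ∩ y ∣ + ⟦ lookup y j ⟧ + ⟦ lookup y i ⟧   ≡⟨ cong (_+ ⟦ lookup y i ⟧) (∣p[x]≔false∩q∣ x y j xj) ⟩
    ∣ x ∩ y ∣ + ⟦ lookup y i ⟧                     ∎
    where
    open ≡-Reasoning
    x′ : Subset n
    x′ = x [ j ]≔ outside
    x′-i : lookup x′ i ≡ false
    x′-i = trans (lookup∘update′ i≢j x outside) xi

  ∣x∩σy∣+1≡∣x∩y∣ : ∀ {x y} → Shiftable x → Shiftable y → ∣ x ∩ σ y ∣ + 1 ≡ ∣ x ∩ y ∣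
  ∣x∩σy∣+1≡∣x∩y∣ {x} {y} (shiftable xj xi) sy = begin
    ∣ x ∩ σ y ∣ + 1                ≡⟨ cong₂ (λ c b → ∣ c ∣ + ⟦ b ⟧) (∩-comm x (σ y)) (sym xj) ⟩
    ∣ σ y ∩ x ∣ + ⟦ lookup x j ⟧   ≡⟨ ∣σx∩y∣+⟦y_j⟧≡∣x∩y∣+⟦y_i⟧ sy x ⟩
    ∣ y ∩ x ∣ + ⟦ lookup x i ⟧     ≡⟨ cong₂ (λ c b → ∣ c ∣ + ⟦ b ⟧) (∩-comm y x) xi ⟩
    ∣ x ∩ y ∣ + 0                  ≡⟨ +-identityʳ _ ⟩
    ∣ x ∩ y ∣                      ∎
    where open ≡-Reasoning

  ∣σx∩σy∣≡∣x∩y∣ : ∀ {x y} → Shiftable x → Shiftable y → ∣ σ x ∩ σ y ∣ ≡ ∣ x ∩ y ∣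
  ∣σx∩σy∣≡∣x∩y∣ {x} {y} sx sy = begin
    ∣ σ x ∩ σ y ∣                      ≡⟨ +-identityʳ _ ⟨
    ∣ σ x ∩ σ y ∣ + 0                  ≡⟨ cong (λ b → ∣ σ x ∩ σ y ∣ + ⟦ b ⟧) (lookup-σ-j y) ⟨
    ∣ σ x ∩ σ y ∣ + ⟦ lookup (σ y) j ⟧ ≡⟨ ∣σx∩y∣+⟦y_j⟧≡∣x∩y∣+⟦y_i⟧ sx (σ y) ⟩
    ∣ x ∩ σ y ∣ + ⟦ lookup (σ y) i ⟧   ≡⟨ cong (λ b → ∣ x ∩ σ y ∣ + ⟦ b ⟧) (lookup-σ-i y) ⟩
    ∣ x ∩ σ y ∣ + 1                    ≡⟨ ∣x∩σy∣+1≡∣x∩y∣ sx sy ⟩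
    ∣ x ∩ y ∣                          ∎
    where open ≡-Reasoning

  ∣σx∣≡∣x∣ : ∀ {x} → Shiftable x → ∣ σ x ∣ ≡ ∣ x ∣
  ∣σx∣≡∣x∣ {x} sx = begin
    ∣ σ x ∣         ≡⟨ cong ∣_∣ (∩-idem (σ x)) ⟨
    ∣ σ x ∩ σ x ∣   ≡⟨ ∣σx∩σy∣≡∣x∩y∣ sx sx ⟩
    ∣ x ∩ x ∣       ≡⟨ cong ∣_∣ (∩-idem x) ⟩
    ∣ x ∣           ∎
    where open ≡-Reasoning

  ∣x∩y∣≡m⇒∣x∩σy∣≢m : ∀ {x y m} → Shiftable x → Shiftable y → ∣ x ∩ y ∣ ≡ m → ∣ x ∩ σ y ∣ ≢ m
  ∣x∩y∣≡m⇒∣x∩σy∣≢m {x} {y} {m} sx sy xy≡m xσy≡m =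
    1+n≢n (trans (+-comm 1 m) (trans (cong (_+ 1) (sym xσy≡m)) (trans (∣x∩σy∣+1≡∣x∩y∣ sx sy) xy≡m)))

  module _ (𝒜 : List (Subset n)) where

    Moving : Subset n → Set
    Moving x = Shiftable x × σ x ∉ 𝒜

    Blocked : Subset n → Set
    Blocked x = Shiftable x × σ x ∈ 𝒜

    data δ-View (x : Subset n) : Subset n → Set where
      moves : Moving x → δ-View x (σ x)
      stays : (Shiftable x → σ x ∈ 𝒜) → δ-View x x

    δ-view : ∀ x → δ-View x (δ i j 𝒜 x)
    δ-view x with j ∈? x | i ∈? x | swapIn i j x ∈𝒜? 𝒜
    ... | yes j∈x | no i∉x  | no σx∉𝒜  =
      moves (shiftable ([]=⇒lookup j∈x) (¬-not (i∉x ∘ lookup⇒[]= i x)) , σx∉𝒜)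
    ... | yes _   | no _    | yes σx∈𝒜 = stays (λ _ → σx∈𝒜)
    ... | yes _   | yes i∈x | _        =
      stays (λ sx → contradiction (trans (sym ([]=⇒lookup i∈x)) (Shiftable.lacks-i sx)) λ ())
    ... | no j∉x  | _       | _        = stays (λ sx → contradiction (lookup⇒[]= j x (Shiftable.has-j sx)) j∉x)

    δ-moving : ∀ {x} → Moving x → δ i j 𝒜 x ≡ σ x
    δ-moving {x} (sx , σx∉𝒜) with δ i j 𝒜 x | δ-view x
    ... | _ | moves _    = refl
    ... | _ | stays stay = contradiction (stay sx) σx∉𝒜

    δ-σ : ∀ x → δ i j 𝒜 (σ x) ≡ σ x
    δ-σ x with δ i j 𝒜 (σ x) | δ-view (σ x)
    ... | _ | moves (sσx , _) = contradiction sσx (σx-unshiftable x)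
    ... | _ | stays _         = refl

    ∣δx∩δx∣≡∣x∩x∣ : ∀ x → ∣ δ i j 𝒜 x ∩ δ i j 𝒜 x ∣ ≡ ∣ x ∩ x ∣
    ∣δx∩δx∣≡∣x∩x∣ x with δ i j 𝒜 x | δ-view x
    ... | _ | moves (sx , _) = ∣σx∩σy∣≡∣x∩y∣ sx sx
    ... | _ | stays _        = refl

    count-δ-diagonal : ∀ m → count (λ x → ∣∩∣≟ m (δ i j 𝒜 x) (δ i j 𝒜 x)) 𝒜 ≡ count (λ x → ∣∩∣≟ m x x) 𝒜
    count-δ-diagonal m =
      count-≐ _ _ ((λ {x} → trans (sym (∣δx∩δx∣≡∣x∩x∣ x))) , (λ {x} → trans (∣δx∩δx∣≡∣x∩x∣ x))) 𝒜

    ∣x∩y∣≡m⇒∣δx∩δσy∣≡m : ∀ {x y m} → Moving x → Blocked y →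
                         ∣ x ∩ y ∣ ≡ m → ∣ δ i j 𝒜 x ∩ δ i j 𝒜 (σ y) ∣ ≡ m
    ∣x∩y∣≡m⇒∣δx∩δσy∣≡m {x} {y} {m} mx@(sx , _) (sy , _) xy≡m = begin
      ∣ δ i j 𝒜 x ∩ δ i j 𝒜 (σ y) ∣ ≡⟨ cong₂ (λ c d → ∣ c ∩ d ∣) (δ-moving mx) (δ-σ y) ⟩
      ∣ σ x ∩ σ y ∣                 ≡⟨ ∣σx∩σy∣≡∣x∩y∣ sx sy ⟩
      ∣ x ∩ y ∣                     ≡⟨ xy≡m ⟩
      m                             ∎
      where open ≡-Reasoning

    Lost : Subset n → Subset n → Set
    Lost x y = (Moving x × Blocked y) ⊎ (Blocked x × Moving y)

    compensate : Subset n × Subset n → Subset n × Subset n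
    compensate (x , y) with σ x ∈𝒜? 𝒜
    ... | yes _ = σ x , y
    ... | no _  = x , σ y

    compensate-moving : ∀ {x} → Moving x → ∀ y → compensate (x , y) ≡ (x , σ y)
    compensate-moving {x} (_ , σx∉𝒜) y with σ x ∈𝒜? 𝒜
    ... | yes σx∈𝒜 = contradiction σx∈𝒜 σx∉𝒜
    ... | no _     = refl

    compensate-blocked : ∀ {x} → Blocked x → ∀ y → compensate (x , y) ≡ (σ x , y)
    compensate-blocked {x} (_ , σx∈𝒜) y with σ x ∈𝒜? 𝒜
    ... | yes _    = refl
    ... | no σx∉𝒜 = contradiction σx∈𝒜 σx∉𝒜

    compensate-injective : ∀ {x y x′ y′} → Lost x y → Lost x′ y′ →
                           compensate (x , y) ≡ compensate (x′ , y′) → (x , y) ≡ (x′ , y′)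
    compensate-injective {x} {y} {x′} {y′} (inj₁ (mx , by)) (inj₁ (mx′ , by′)) eq =
      cong₂ _,_ (,-injectiveˡ e) (σ-injective (proj₁ by) (proj₁ by′) (,-injectiveʳ e))
      where
      e : (x , σ y) ≡ (x′ , σ y′)
      e = trans (sym (compensate-moving mx y)) (trans eq (compensate-moving mx′ y′))
    compensate-injective {x} {y} {x′} {y′} (inj₂ (bx , my)) (inj₂ (bx′ , my′)) eq =
      cong₂ _,_ (σ-injective (proj₁ bx) (proj₁ bx′) (,-injectiveˡ e)) (,-injectiveʳ e)
      where
      e : (σ x , y) ≡ (σ x′ , y′)
      e = trans (sym (compensate-blocked bx y)) (trans eq (compensate-blocked bx′ y′))
    compensate-injective {x} {y} {x′} {y′} (inj₁ (mx , _)) (inj₂ (bx′ , _)) eq =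
      contradiction (subst Shiftable (,-injectiveˡ e) (proj₁ mx)) (σx-unshiftable x′)
      where
      e : (x , σ y) ≡ (σ x′ , y′)
      e = trans (sym (compensate-moving mx y)) (trans eq (compensate-blocked bx′ y′))
    compensate-injective {x} {y} {x′} {y′} (inj₂ (bx , _)) (inj₁ (mx′ , _)) eq =
      contradiction (subst Shiftable (sym (,-injectiveˡ e)) (proj₁ mx′)) (σx-unshiftable x)
      where
      e : (σ x , y) ≡ (x′ , σ y′)
      e = trans (sym (compensate-blocked bx y)) (trans eq (compensate-moving mx′ y′))

    module _ {k} (𝒜-uniform : ∀ x → x ∈ 𝒜 → ∣ x ∣ ≡ k) where

      blocked-partner : ∀ {x y} → x ∈ 𝒜 → y ∈ 𝒜 → Moving x → (Shiftable y → σ y ∈ 𝒜) →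
                        ∣ x ∩ y ∣ ≡ k ∸ 1 → ∣ σ x ∩ y ∣ ≢ k ∸ 1 → Blocked y
      blocked-partner {x} {y} x∈𝒜 y∈𝒜 (sx , σx∉𝒜) stay xy≡m σxy≢m
        with lookup y j in yj | lookup y i in yi | ∣σx∩y∣+⟦y_j⟧≡∣x∩y∣+⟦y_i⟧ sx y
      ... | true  | false | _ = let sy = shiftable yj yi in sy , stay sy
      ... | true  | true  | e = contradiction (trans (+-cancelʳ-≡ 1 _ _ e) xy≡m) σxy≢m
      ... | false | false | e = contradiction (trans (+-cancelʳ-≡ 0 _ _ e) xy≡m) σxy≢m
      ... | false | true  | e = contradiction (subst (_∈ 𝒜) (sym σx≡y) y∈𝒜) σx∉𝒜
        where
        -- The only case that uses uniformity and m = k − 1: |σx ∩ y| = k = |σx| = |y| forces σx = y.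
        ∣σx∩y∣≡m+1 : ∣ σ x ∩ y ∣ ≡ k ∸ 1 + 1
        ∣σx∩y∣≡m+1 = trans (sym (+-identityʳ _)) (trans e (cong (_+ 1) xy≡m))
        m+1≤k : k ∸ 1 + 1 ≤ k
        m+1≤k = subst₂ _≤_ ∣σx∩y∣≡m+1 (𝒜-uniform y y∈𝒜) (∣p∩q∣≤∣q∣ (σ x) y)
        ∣σx∩y∣≡k : ∣ σ x ∩ y ∣ ≡ k
        ∣σx∩y∣≡k = trans ∣σx∩y∣≡m+1 (m∸n+n≡m (≤-trans (m≤n+m 1 (k ∸ 1)) m+1≤k))
        σx∩y≡σx : σ x ∩ y ≡ σ x
        σx∩y≡σx = p⊆q∧∣p∣≡∣q∣⇒p≡q (p∩q⊆p (σ x) y) (trans ∣σx∩y∣≡k (sym (trans (∣σx∣≡∣x∣ sx) (𝒜-uniform x x∈𝒜))))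
        σx∩y≡y : σ x ∩ y ≡ y
        σx∩y≡y = p⊆q∧∣p∣≡∣q∣⇒p≡q (p∩q⊆q (σ x) y) (trans ∣σx∩y∣≡k (sym (𝒜-uniform y y∈𝒜)))
        σx≡y : σ x ≡ y
        σx≡y = trans (sym σx∩y≡σx) σx∩y≡y

      lost : ∀ {x y} → x ∈ 𝒜 → y ∈ 𝒜 →
             ∣ x ∩ y ∣ ≡ k ∸ 1 → ∣ δ i j 𝒜 x ∩ δ i j 𝒜 y ∣ ≢ k ∸ 1 → Lost x y
      lost {x} {y} x∈𝒜 y∈𝒜 xy≡m δxy≢m with δ i j 𝒜 x | δ-view x | δ i j 𝒜 y | δ-view y
      ... | _ | moves (sx , _) | _ | moves (sy , _) = contradiction (trans (∣σx∩σy∣≡∣x∩y∣ sx sy) xy≡m) δxy≢m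
      ... | _ | stays _        | _ | stays _        = contradiction xy≡m δxy≢m
      ... | _ | moves mx       | _ | stays stay     = inj₁ (mx , blocked-partner x∈𝒜 y∈𝒜 mx stay xy≡m δxy≢m)
      ... | _ | stays stay     | _ | moves my       =
        inj₂ ( blocked-partner y∈𝒜 x∈𝒜 my stay (trans (∣∩∣-comm y x) xy≡m) (δxy≢m ∘ trans (∣∩∣-comm x (σ y)))
             , my)

      countOrdered-δ-mono : Unique 𝒜 →
        countOrdered (∣∩∣≟ (k ∸ 1)) 𝒜 𝒜 ≤ countOrdered (λ x y → ∣∩∣≟ (k ∸ 1) (δ i j 𝒜 x) (δ i j 𝒜 y)) 𝒜 𝒜
      countOrdered-δ-mono 𝒜! =
        count-≤-exchange (uncurry (∣∩∣≟ (k ∸ 1))) (uncurry λ x y → ∣∩∣≟ (k ∸ 1) (δ i j 𝒜 x) (δ i j 𝒜 y))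
          compensate (Unique.cartesianProduct⁺ 𝒜! 𝒜!) gains
          (λ p∈ q∈ p-lost q-lost → compensate-injective (lost-pair p∈ p-lost) (lost-pair q∈ q-lost))
        where
        Meets Meetsδ : Subset n × Subset n → Set
        Meets (x , y) = ∣ x ∩ y ∣ ≡ k ∸ 1
        Meetsδ (x , y) = ∣ δ i j 𝒜 x ∩ δ i j 𝒜 y ∣ ≡ k ∸ 1

        lost-pair : ∀ {p} → p ∈ cartesianProduct 𝒜 𝒜 → Meets p × ¬ Meetsδ p → Lost (proj₁ p) (proj₂ p)
        lost-pair p∈ (xy≡m , δxy≢m) = let x∈𝒜 , y∈𝒜 = ∈-cartesianProduct⁻ 𝒜 𝒜 p∈ in lost x∈𝒜 y∈𝒜 xy≡m δxy≢m

        gains : ∀ {p} → p ∈ cartesianProduct 𝒜 𝒜 → Meets p → ¬ Meetsδ p →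
                compensate p ∈ cartesianProduct 𝒜 𝒜 × Meetsδ (compensate p) × ¬ Meets (compensate p)
        gains {x , y} xy∈ xy≡m δxy≢m with ∈-cartesianProduct⁻ 𝒜 𝒜 xy∈ | lost-pair xy∈ (xy≡m , δxy≢m)
        ... | x∈𝒜 , _ | inj₁ (mx , by@(sy , σy∈𝒜)) rewrite compensate-moving mx y =
          ∈-cartesianProduct⁺ x∈𝒜 σy∈𝒜 ,
          ∣x∩y∣≡m⇒∣δx∩δσy∣≡m mx by xy≡m ,
          ∣x∩y∣≡m⇒∣x∩σy∣≢m (proj₁ mx) sy xy≡m
        ... | _ , y∈𝒜 | inj₂ (bx@(sx , σx∈𝒜) , my) rewrite compensate-blocked bx y =
          ∈-cartesianProduct⁺ σx∈𝒜 y∈𝒜 ,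
          trans (∣∩∣-comm (δ i j 𝒜 (σ x)) (δ i j 𝒜 y)) (∣x∩y∣≡m⇒∣δx∩δσy∣≡m my bx yx≡m) ,
          ∣x∩y∣≡m⇒∣x∩σy∣≢m (proj₁ my) sx yx≡m ∘ trans (∣∩∣-comm y (σ x))
          where
          yx≡m : ∣ y ∩ x ∣ ≡ k ∸ 1
          yx≡m = trans (∣∩∣-comm y x) xy≡m

lemma2 : (n k t : ℕ) (𝒜 : List (Subset n)) → IsFamily k 𝒜 → IsTIntersecting t 𝒜 →
           (i j : Fin n) → i < j → ζ (k ∸ 1) 𝒜 ≤ ζ (k ∸ 1) (Δ i j 𝒜)
lemma2 n k t 𝒜 (𝒜! , 𝒜-uniform) _ i j i<j = *-cancelˡ-≤ 2 (+-cancelˡ-≤ diagonal _ _ (begin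
  diagonal + 2 * ζ m 𝒜
    ≡⟨ cong (λ c → diagonal + 2 * c) (ζ≡countPairs m 𝒜) ⟩
  diagonal + 2 * countPairs R? 𝒜
    ≡⟨ countOrdered-diagonal R? (λ {x} {y} → trans (∣∩∣-comm y x)) 𝒜 ⟨
  countOrdered R? 𝒜 𝒜
    ≤⟨ countOrdered-δ-mono 𝒜 𝒜-uniform 𝒜! ⟩
  countOrdered Rδ? 𝒜 𝒜
    ≡⟨ countOrdered-diagonal Rδ? (λ {x} {y} → trans (∣∩∣-comm (δ′ y) (δ′ x))) 𝒜 ⟩
  count (λ x → Rδ? x x) 𝒜 + 2 * countPairs Rδ? 𝒜
    ≡⟨ cong₂ (λ c d → c + 2 * d) (count-δ-diagonal 𝒜 m) (sym (countPairs-map R? δ′ 𝒜)) ⟩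
  diagonal + 2 * countPairs R? (Δ i j 𝒜)
    ≡⟨ cong (λ c → diagonal + 2 * c) (ζ≡countPairs m (Δ i j 𝒜)) ⟨
  diagonal + 2 * ζ m (Δ i j 𝒜)
    ∎))
  where
  open Shift (Fin.<⇒≢ i<j)
  open ≤-Reasoning
  m : ℕ
  m = k ∸ 1
  δ′ : Subset n → Subset n
  δ′ = δ i j 𝒜
  R? : (x y : Subset n) → Dec (∣ x ∩ y ∣ ≡ m)
  R? = ∣∩∣≟ m
  Rδ? : (x y : Subset n) → Dec (∣ δ′ x ∩ δ′ y ∣ ≡ m)
  Rδ? x y = R? (δ′ x) (δ′ y)
  diagonal : ℕ
  diagonal = count (λ x → R? x x) 𝒜
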